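{- Let $G$ be a complete multipartite graph. Then every complete expansion $\mathbb{K}[G]$ of $G$ is $k$-indicated colorable for every $k\geq\chi(\mathbb{K}[G])$.
   Context: All graphs are finite, simple and undirected. Indicated coloring game with $k$ colors: each round Ann selects an uncolored vertex and Ben colors it properly with one of the $k$ colors; Ann wins if all vertices get colored, Ben wins if some uncolored vertex has all $k$ colors on its neighbors. A graph is $k$-indicated colorable if Ann has a winning strategy with $k$ colors. For $G$ on vertices $v_1,\dots,v_n$ and positive integers $m_1,\dots,m_n$, the complete expansion $\mathbb{K}[G](m_1,\dots,m_n)$ replaces each $v_i$ by a complete graph $K_{m_i}$ and joins all vertices of the $i$-th and $j$-th copies whenever $v_iv_j\in E(G)$. -}

module Defs where

open import Data.Nat using (ℕ; _≤_)
open import Data.Fin using (Fin; toℕ)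
open import Data.Bool using (Bool; true; false; if_then_else_; not)
open import Data.Maybe using (Maybe; just; nothing)
open import Data.Product using (Σ; Σ-syntax; _×_; _,_)
open import Relation.Nullary using (¬_; yes; no)
open import Relation.Nullary.Decidable using (⌊_⌋)
open import Relation.Binary.PropositionalEquality using (_≡_; _≢_)
open import Relation.Binary.Definitions using (DecidableEquality)
import Data.Fin.Properties as FinP
import Data.Nat.Properties as NatP
import Data.Product.Properties as ProdP

record Graph (n : ℕ) : Set where
  field
    Adj    : Fin n → Fin n → Bool
    sym    : ∀ u v → Adj u v ≡ Adj v u
    irrefl : ∀ v → Adj v v ≡ false

open Graph public

IsCompleteMultipartite : ∀ {n} → Graph n → Set
IsCompleteMultipartite {n} G =
  Σ[ p ∈ ℕ ] Σ[ part ∈ (Fin n → Fin p) ]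
    (∀ u v → (Adj G u v ≡ true → part u ≢ part v) × (part u ≢ part v → Adj G u v ≡ true))

-- Complete expansion K[G](m_1,...,m_n).
-- Vertex set: pairs (i , a) with a : Fin (m i) (the i-th copy of K_{m i}).
-- (i , a) ~ (j , b)  iff  (i = j and a ≠ b)  or  v_i v_j ∈ E(G).

ExpV : ∀ {n} → (Fin n → ℕ) → Set
ExpV {n} m = Σ (Fin n) (λ i → Fin (m i))

_≟E_ : ∀ {n} {m : Fin n → ℕ} → DecidableEquality (ExpV m)
_≟E_ = ProdP.≡-dec FinP._≟_ FinP._≟_

expAdj : ∀ {n} → Graph n → (m : Fin n → ℕ) → ExpV m → ExpV m → Bool
expAdj G m (i , a) (j , b) =
  if ⌊ i FinP.≟ j ⌋ then not ⌊ toℕ a NatP.≟ toℕ b ⌋ else Adj G i j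

module _ {V : Set} (_≟_ : DecidableEquality V) (adj : V → V → Bool) (k : ℕ) where

  PartialColoring : Set
  PartialColoring = V → Maybe (Fin k)

  Available : PartialColoring → V → Fin k → Set
  Available c v a = ∀ u → adj u v ≡ true → c u ≢ just a

  update : PartialColoring → V → Fin k → PartialColoring
  update c v a u with u ≟ v
  ... | yes _ = just a
  ... | no  _ = c u

  -- Ann has a winning strategy from position c (Ann to move):
  --  * every vertex is colored: Ann has won; or
  --  * Ann indicates an uncolored vertex v that Ben can still color properly
  --    (otherwise Ben wins), and whatever proper color Ben gives v,
  --    Ann wins from the resulting position.
  data AnnWins (c : PartialColoring) : Set where
    done : (∀ v → Σ[ a ∈ Fin k ] c v ≡ just a) → AnnWins c
    step : (v : V) → c v ≡ nothing →
           Σ[ a ∈ Fin k ] Available c v a →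
           (∀ a → Available c v a → AnnWins (update c v a)) →
           AnnWins c

  IndicatedColorable : Set
  IndicatedColorable = AnnWins (λ _ → nothing)

module _ {V : Set} (adj : V → V → Bool) where

  Colorable : ℕ → Set
  Colorable k = Σ[ f ∈ (V → Fin k) ] (∀ u v → adj u v ≡ true → f u ≢ f v)

  IsChromaticNumber : ℕ → Set
  IsChromaticNumber χ = Colorable χ × (∀ k → Colorable k → χ ≤ k)

module Submission where

-- Let G be complete multipartite with classes given by part, and K = K[G](m).  In every
-- class choose a leader, a vertex i of G with m i maximal in its class; the copies of the
-- leaders form a clique W of K.  Ann plays in two phases.
--   Phase 1: she presents the vertices of W.  The coloured neighbours of a vertex v of W
--     lie in W, hence form a clique, so a proper χ-colouring f of K labels them injectively
--     by values different from f v; fewer than χ ≤ k colours are therefore blocked.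
--   Phase 2: she presents all remaining vertices.  A vertex (i , a) of the copy of i is
--     adjacent to every vertex outside its class, and not to the leader copy i* of its
--     class, which carries m i* ≥ m i distinct colours.  A neighbour carrying one of these
--     colours cannot lie outside the class, so it lies in the copy of i, distinct from
--     (i , a): at most m i - 1 of those colours are blocked.

open import Defs hiding (sym)
open import Data.Nat using (ℕ; zero; suc; _≤_; _>_)
open import Data.Fin using (Fin; toℕ; punchOut; inject≤)
import Data.Fin.Properties as FinP
import Data.Nat.Properties as NatP
open import Data.Bool using (Bool; true; false; not)
import Data.Bool.Properties as BoolP
open import Data.Maybe using (just; nothing)
open import Data.Maybe.Properties using (just-injective)
import Data.Maybe.Properties as MaybeP
open import Data.Product using (Σ; Σ-syntax; _×_; _,_; proj₁; proj₂)
open import Data.Unit using (⊤; tt)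
open import Data.Empty using (⊥; ⊥-elim)
open import Data.List using (List; []; _∷_; map; concatMap; filter; allFin)
open import Data.List.Relation.Unary.All using (All; []; _∷_)
import Data.List.Relation.Unary.All as All
open import Data.List.Relation.Unary.All.Properties using (all-filter)
open import Data.List.Relation.Unary.Any using (here; there; satisfied)
import Data.List.Relation.Unary.Any as Any
open import Data.List.Membership.Propositional using (_∈_; lose)
open import Data.List.Membership.Propositional.Properties
  using (∈-map⁺; ∈-concatMap⁺; ∈-allFin; ∈-filter⁺)
open import Data.List.Extrema.Nat using (argmax; argmax-all; f[⊥]≤f[argmax]; f[xs]≤f[argmax])
open import Relation.Nullary using (¬_; yes; no; Dec; ¬?)
open import Relation.Nullary.Decidable
  using (⌊_⌋; _×-dec_; map′; decidable-stable; dec-true; dec-false; does-⇔; isYes≗does)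
open import Relation.Unary using (Decidable)
open import Relation.Binary.PropositionalEquality using (_≡_; _≢_; refl; sym; trans; cong)
open import Relation.Binary.Definitions using (DecidableEquality)
open import Function using (_∘_; id)
open import Function.Bundles using (mk⇔)
open import Function.Definitions using (Injective)

just≢nothing : ∀ {A : Set} {x : A} → just x ≢ nothing
just≢nothing ()

∈-tail : ∀ {A : Set} {u w : A} {xs : List A} → u ∈ w ∷ xs → u ≢ w → u ∈ xs
∈-tail (here u≡w) u≢w = ⊥-elim (u≢w u≡w)
∈-tail (there u∈xs) _ = u∈xs

module Game {V : Set} (_≟_ : DecidableEquality V) (adj : V → V → Bool) (k : ℕ)
  (adj-sym : ∀ u w → adj u w ≡ adj w u) (adj-irrefl : ∀ u → adj u u ≡ false)
  (vertices : List V) (∈-vertices : ∀ u → u ∈ vertices) where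

  Coloring : Set
  Coloring = PartialColoring _≟_ adj k

  Avail : Coloring → V → Fin k → Set
  Avail = Available _≟_ adj k

  upd : Coloring → V → Fin k → Coloring
  upd = update _≟_ adj k

  Wins : Coloring → Set
  Wins = AnnWins _≟_ adj k

  Colored : Coloring → V → Set
  Colored c v = Σ[ x ∈ Fin k ] c v ≡ just x

  not-adjacent-to-itself : ∀ {u w} → u ≡ w → adj u w ≢ true
  not-adjacent-to-itself {u} refl uu with () ← trans (sym uu) (adj-irrefl u)

  update-here : ∀ c v a → upd c v a v ≡ just a
  update-here c v a with v ≟ v
  ... | yes _ = refl
  ... | no v≢v = ⊥-elim (v≢v refl)

  update-there : ∀ c v a {u} → u ≢ v → upd c v a u ≡ c u
  update-there c v a {u} u≢v with u ≟ v
  ... | yes u≡v = ⊥-elim (u≢v u≡v)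
  ... | no _ = refl

  update-nothing : ∀ c v a {u} → upd c v a u ≡ nothing → u ≢ v × c u ≡ nothing
  update-nothing c v a {u} e = u≢v , trans (sym (update-there c v a u≢v)) e
    where
    u≢v : u ≢ v
    u≢v refl = just≢nothing (trans (sym (update-here c u a)) e)

  Proper : Coloring → Set
  Proper c = ∀ u w {x} → adj u w ≡ true → c u ≡ just x → c w ≡ just x → ⊥

  proper-update : ∀ {c v a} → Proper c → Avail c v a → Proper (upd c v a)
  proper-update {c} {v} {a} proper av u w uw cu cw with u ≟ v | w ≟ v
  ... | yes refl | yes refl = not-adjacent-to-itself refl uw
  ... | yes refl | no _ = av w (trans (adj-sym w u) uw) (trans cw (sym cu))
  ... | no _ | yes refl = av u uw (trans cu (sym cw))
  ... | no _ | no _ = proper u w uw cu cw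

  Blocked : Coloring → V → Fin k → Set
  Blocked c v x = Σ[ u ∈ V ] (adj u v ≡ true × c u ≡ just x)

  -- availability is decidable because the vertices are enumerated
  blocked? : ∀ c v x → Dec (Blocked c v x)
  blocked? c v x =
    map′ satisfied (λ (u , b) → lose (∈-vertices u) b)
      (Any.any? (λ u → (adj u v BoolP.≟ true) ×-dec MaybeP.≡-dec FinP._≟_ (c u) (just x)) vertices)

  available? : ∀ c v x → Dec (Avail c v x)
  available? c v x =
    map′ (λ unblocked u p q → unblocked (u , p , q)) (λ av (u , p , q) → av u p q) (¬? (blocked? c v x))

  unavailable⇒blocked : ∀ {c v x} → ¬ Avail c v x → Blocked c v x
  unavailable⇒blocked {c} {v} {x} na =
    decidable-stable (blocked? c v x) (λ unblocked → na (λ u p q → unblocked (u , p , q)))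

  CandidateNeighbour : Coloring → V → ∀ {r} → (Fin r → Fin k) → Set
  CandidateNeighbour c v {r} g = Σ[ u ∈ V ] (adj u v ≡ true × Σ[ a ∈ Fin r ] c u ≡ just (g a))

  available-by-counting : ∀ c v {r t} → t ≤ r → (g : Fin r → Fin k) → Injective _≡_ _≡_ g →
    (z : Fin t) (label : CandidateNeighbour c v g → Fin t) →
    (∀ y → label y ≢ z) → (∀ y y' → label y ≡ label y' → proj₁ y ≡ proj₁ y') →
    Σ (Fin k) (Avail c v)
  available-by-counting c v {t = zero} _ _ _ () _ _ _
  available-by-counting c v {t = suc s} t≤r g g-injective z label avoids label-injective
    with FinP.any? (λ a → available? c v (g a))
  ... | yes (a , av) = g a , av
  ... | no none = ⊥-elim (FinP.<⇒notInjective t≤r blocking-injective)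
    where
    blocking : ∀ a → CandidateNeighbour c v g
    blocking a with unavailable⇒blocked (λ av → none (a , av))
    ... | u , p , q = u , p , a , q

    blocking-label : ∀ a → Fin s
    blocking-label a = punchOut (avoids (blocking a) ∘ sym)

    blocking-injective : Injective _≡_ _≡_ blocking-label
    blocking-injective {a} {a'} eq =
      g-injective (just-injective (trans (sym (colour a)) (trans (cong c same-vertex) (colour a'))))
      where
      colour : ∀ b → c (proj₁ (blocking b)) ≡ just (g b)
      colour b with unavailable⇒blocked (λ av → none (b , av))
      ... | _ , _ , q = q
      same-vertex : proj₁ (blocking a) ≡ proj₁ (blocking a')
      same-vertex = label-injective (blocking a) (blocking a')
        (FinP.punchOut-injective (avoids (blocking a) ∘ sym) (avoids (blocking a') ∘ sym) eq)

  -- Ann presents, in the order of `todo`, every still uncoloured vertex satisfying P.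
  -- If such vertices can always be coloured and the invariant Inv is preserved, she
  -- reaches a proper position satisfying Inv in which every P-vertex is coloured.
  module Presenting (P : V → Set) (P? : Decidable P) (Inv : Coloring → Set)
    (colourable : ∀ c v → Proper c → Inv c → P v → c v ≡ nothing → Σ (Fin k) (Avail c v))
    (preserved : ∀ c v a → Inv c → P v → Avail c v a → Inv (upd c v a))
    (finish : ∀ c → Proper c → Inv c → (∀ v → P v → Colored c v) → Wins c) where

    present : ∀ todo c → Proper c → Inv c → (∀ v → P v → c v ≡ nothing → v ∈ todo) → Wins c
    present [] c proper inv pending = finish c proper inv coloured
      where
      coloured : ∀ v → P v → Colored c v
      coloured v pv with c v in cv
      ... | just x = x , refl
      ... | nothing with () ← pending v pv cv
    present (w ∷ todo) c proper inv pending with P? w | c w in cw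
    ... | no ¬pw | _ =
      present todo c proper inv (λ v pv e → ∈-tail (pending v pv e) λ { refl → ¬pw pv })
    ... | yes _ | just _ =
      present todo c proper inv
        (λ v pv e → ∈-tail (pending v pv e) λ { refl → just≢nothing (trans (sym cw) e) })
    ... | yes pw | nothing =
      step w cw (colourable c w proper inv pw cw) λ a av →
        present todo (upd c w a) (proper-update proper av) (preserved c w a inv pw av)
          (λ v pv e → let v≢w , cv = update-nothing c w a e in ∈-tail (pending v pv cv) v≢w)

module Expansion {n} (G : Graph n) (m : Fin n → ℕ) where

  E : ExpV m → ExpV m → Bool
  E = expAdj G m

  within : ∀ i (a b : Fin (m i)) → E (i , a) (i , b) ≡ not ⌊ toℕ a NatP.≟ toℕ b ⌋
  within i a b with i FinP.≟ i
  ... | yes _ = refl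
  ... | no i≢i = ⊥-elim (i≢i refl)

  across : ∀ {i j} (a : Fin (m i)) (b : Fin (m j)) → i ≢ j → E (i , a) (j , b) ≡ Adj G i j
  across {i} {j} a b i≢j with i FinP.≟ j
  ... | yes i≡j = ⊥-elim (i≢j i≡j)
  ... | no _ = refl

  decided-sym : ∀ x y → ⌊ x NatP.≟ y ⌋ ≡ ⌊ y NatP.≟ x ⌋
  decided-sym x y = trans (isYes≗does (x NatP.≟ y))
    (trans (does-⇔ (mk⇔ (λ e → sym e) (λ e → sym e)) (x NatP.≟ y) (y NatP.≟ x))
           (sym (isYes≗does (y NatP.≟ x))))

  decided-true : ∀ {x y} → x ≡ y → ⌊ x NatP.≟ y ⌋ ≡ true
  decided-true {x} {y} x≡y = trans (isYes≗does (x NatP.≟ y)) (dec-true (x NatP.≟ y) x≡y)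

  decided-false : ∀ {x y} → x ≢ y → ⌊ x NatP.≟ y ⌋ ≡ false
  decided-false {x} {y} x≢y = trans (isYes≗does (x NatP.≟ y)) (dec-false (x NatP.≟ y) x≢y)

  E-sym : ∀ u w → E u w ≡ E w u
  E-sym (i , a) (j , b) with i FinP.≟ j
  ... | yes refl = trans (cong not (decided-sym (toℕ a) (toℕ b))) (sym (within i b a))
  ... | no i≢j = trans (Graph.sym G i j) (sym (across b a (i≢j ∘ sym)))

  E-irrefl : ∀ u → E u u ≡ false
  E-irrefl (i , a) = trans (within i a a) (cong not (decided-true refl))

  copy-adjacent : ∀ i {a b : Fin (m i)} → a ≢ b → E (i , a) (i , b) ≡ true
  copy-adjacent i {a} {b} a≢b =
    trans (within i a b) (cong not (decided-false (a≢b ∘ FinP.toℕ-injective)))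

  copy : (i : Fin n) → List (ExpV m)
  copy i = map (i ,_) (allFin (m i))

  vertices : List (ExpV m)
  vertices = concatMap copy (allFin n)

  ∈-vertices : ∀ u → u ∈ vertices
  ∈-vertices (i , a) = ∈-concatMap⁺ copy (lose (∈-allFin i) (∈-map⁺ (i ,_) (∈-allFin a)))

module Leaders {n p} (part : Fin n → Fin p) (m : Fin n → ℕ) where

  classmates : Fin p → List (Fin n)
  classmates q = filter (λ j → part j FinP.≟ q) (allFin n)

  in-own-class : ∀ i → i ∈ classmates (part i)
  in-own-class i = ∈-filter⁺ (λ j → part j FinP.≟ part i) (∈-allFin i) refl

  -- an m-maximal element of a list; the default d is used only for the empty list
  best : List (Fin n) → Fin n → Fin n
  best [] d = d
  best (x ∷ xs) _ = argmax m x xs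

  best-default : ∀ {y xs} → y ∈ xs → ∀ d d' → best xs d ≡ best xs d'
  best-default {xs = _ ∷ _} _ _ _ = refl

  best-all : ∀ {Q : Fin n → Set} {xs d} → Q d → All Q xs → Q (best xs d)
  best-all qd [] = qd
  best-all _ (qx ∷ qxs) = argmax-all m qx qxs

  best-max : ∀ {y xs} → y ∈ xs → ∀ d → m y ≤ m (best xs d)
  best-max {xs = x ∷ xs} (here refl) _ = f[⊥]≤f[argmax] {f = m} x xs
  best-max {xs = x ∷ xs} (there y∈xs) _ = All.lookup (f[xs]≤f[argmax] {f = m} x xs) y∈xs

  leader : Fin n → Fin n
  leader i = best (classmates (part i)) i

  leader-class : ∀ i → part (leader i) ≡ part i
  leader-class i = best-all refl (all-filter (λ j → part j FinP.≟ part i) (allFin n))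

  leader-max : ∀ i → m i ≤ m (leader i)
  leader-max i = best-max (in-own-class i) i

  leader-cong : ∀ {i j} → part i ≡ part j → leader i ≡ leader j
  leader-cong {i} {j} eq =
    trans (cong (λ q → best (classmates q) i) eq) (best-default (in-own-class j) i j)

  leader-leads : ∀ i → leader (leader i) ≡ leader i
  leader-leads i = leader-cong (leader-class i)

  leaders-unique : ∀ {i j} → leader i ≡ i → leader j ≡ j → part i ≡ part j → i ≡ j
  leaders-unique li lj eq = trans (sym li) (trans (leader-cong eq) lj)

module Strategy {n p} (G : Graph n) (part : Fin n → Fin p)
  (multipartite : ∀ i j → (Adj G i j ≡ true → part i ≢ part j) × (part i ≢ part j → Adj G i j ≡ true))
  (m : Fin n → ℕ) {χ} (f : ExpV m → Fin χ) (f-proper : ∀ u w → expAdj G m u w ≡ true → f u ≢ f w)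
  (k : ℕ) (χ≤k : χ ≤ k) where

  open Expansion G m
  open Leaders part m
  open Game _≟E_ E k E-sym E-irrefl vertices ∈-vertices

  classes-adjacent : ∀ {i j} (a : Fin (m i)) (b : Fin (m j)) → part i ≢ part j → E (i , a) (j , b) ≡ true
  classes-adjacent a b pi≢pj = trans (across a b (pi≢pj ∘ cong part)) (proj₂ (multipartite _ _) pi≢pj)

  Leading : ExpV m → Set
  Leading (i , _) = leader i ≡ i

  leading? : Decidable Leading
  leading? (i , _) = leader i FinP.≟ i

  -- W is a clique: its copies lie in distinct classes
  -- (matching on i ≟ j evaluates the adjacency test)
  W-clique : ∀ {u w} → u ≢ w → Leading u → Leading w → E u w ≡ true
  W-clique {i , a} {j , b} u≢w li lj with i FinP.≟ j
  ... | yes refl = cong not (decided-false (λ a≡b → u≢w (cong (i ,_) (FinP.toℕ-injective a≡b))))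
  ... | no i≢j = proj₂ (multipartite i j) (i≢j ∘ leaders-unique li lj)

  OnlyW : Coloring → Set
  OnlyW c = ∀ u {x} → c u ≡ just x → Leading u

  -- a vertex of W can be coloured: its coloured neighbours form a clique, labelled
  -- injectively by the proper χ-colouring f, avoiding f v
  W-colourable : ∀ c v → Proper c → OnlyW c → Leading v → c v ≡ nothing → Σ (Fin k) (Avail c v)
  W-colourable c v _ onlyW _ _ =
    available-by-counting c v χ≤k id id (f v) (f ∘ proj₁) (λ (u , uv , _) → f-proper u v uv)
      f-separates
    where
    f-separates : ∀ y y' → f (proj₁ y) ≡ f (proj₁ y') → proj₁ y ≡ proj₁ y'
    f-separates (u , _ , _ , cu) (u' , _ , _ , cu') fu≡fu' with u ≟E u'
    ... | yes u≡u' = u≡u'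
    ... | no u≢u' = ⊥-elim (f-proper u u' (W-clique u≢u' (onlyW u cu) (onlyW u' cu')) fu≡fu')

  OnlyW-preserved : ∀ c v a → OnlyW c → Leading v → Avail c v a → OnlyW (upd c v a)
  OnlyW-preserved c v a onlyW lv _ u cu with u ≟E v
  ... | yes refl = lv
  ... | no _ = onlyW u cu

  WColored : Coloring → Set
  WColored c = ∀ u → Leading u → Colored c u

  WColored-preserved : ∀ c v a → WColored c → ⊤ → Avail c v a → WColored (upd c v a)
  WColored-preserved c v a wColored _ _ u lu with u ≟E v
  ... | yes refl = a , refl
  ... | no _ = wColored u lu

  in-copy : ∀ {i j} (b : Fin (m j)) → j ≡ i → Σ[ b' ∈ Fin (m i) ] (j , b) ≡ (i , b')
  in-copy b refl = b , refl

  -- Once W is coloured, every vertex (i , a₀) can be coloured with a colour of the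
  -- leader copy of its class.
  colourable-after-W : ∀ c v → Proper c → WColored c → ⊤ → c v ≡ nothing → Σ (Fin k) (Avail c v)
  colourable-after-W c (i , a₀) proper wColored _ _ =
    available-by-counting c (i , a₀) NatP.≤-refl g g-injective a₀ position position-avoids
      position-injective
    where
    leader-vertex : Fin (m i) → ExpV m
    leader-vertex a = leader i , inject≤ a (leader-max i)

    g : Fin (m i) → Fin k
    g a = proj₁ (wColored (leader-vertex a) (leader-leads i))

    g-colours : ∀ a → c (leader-vertex a) ≡ just (g a)
    g-colours a = proj₂ (wColored (leader-vertex a) (leader-leads i))

    g-injective : Injective _≡_ _≡_ g
    g-injective {a} {a'} ga≡ga' with a FinP.≟ a'
    ... | yes a≡a' = a≡a'
    ... | no a≢a' = ⊥-elim (proper (leader-vertex a) (leader-vertex a')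
      (copy-adjacent (leader i) (a≢a' ∘ FinP.inject≤-injective _ _ a a'))
      (g-colours a) (trans (g-colours a') (cong just (sym ga≡ga'))))

    -- a candidate-coloured neighbour lies in the copy of i: otherwise it is in another
    -- class and adjacent to the leader vertex of the same colour (matching on j ≟ i
    -- evaluates its adjacency to (i , a₀) to Adj G j i)
    same-copy : (y : CandidateNeighbour c (i , a₀) g) → proj₁ (proj₁ y) ≡ i
    same-copy ((j , b) , adjacent , a , cu) with j FinP.≟ i
    ... | yes j≡i = j≡i
    ... | no j≢i = ⊥-elim (proper (j , b) (leader-vertex a)
      (classes-adjacent b _ (λ pj≡pl → proj₁ (multipartite j i) adjacent (trans pj≡pl (leader-class i))))
      cu (g-colours a))

    placement : (y : CandidateNeighbour c (i , a₀) g) → Σ[ b ∈ Fin (m i) ] proj₁ y ≡ (i , b)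
    placement y = in-copy (proj₂ (proj₁ y)) (same-copy y)

    position : CandidateNeighbour c (i , a₀) g → Fin (m i)
    position y = proj₁ (placement y)

    position-avoids : ∀ y → position y ≢ a₀
    position-avoids y b≡a₀ =
      not-adjacent-to-itself (trans (proj₂ (placement y)) (cong (i ,_) b≡a₀)) (proj₁ (proj₂ y))

    position-injective : ∀ y y' → position y ≡ position y' → proj₁ y ≡ proj₁ y'
    position-injective y y' eq =
      trans (proj₂ (placement y)) (trans (cong (i ,_) eq) (sym (proj₂ (placement y'))))

  module Phase₂ = Presenting (λ _ → ⊤) (λ _ → yes tt) WColored colourable-after-W WColored-preserved
    (λ c _ _ coloured → done (λ v → coloured v tt))

  module Phase₁ = Presenting Leading leading? OnlyW W-colourable OnlyW-preserved
    (λ c proper _ wColored →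
      Phase₂.present vertices c proper wColored (λ v _ _ → ∈-vertices v))

  ann-wins : IndicatedColorable _≟E_ E k
  ann-wins = Phase₁.present vertices (λ _ → nothing) (λ _ _ _ ()) (λ _ ()) (λ v _ _ → ∈-vertices v)

theorem3p17 : ∀ {n} (G : Graph n) → IsCompleteMultipartite G →
    (m : Fin n → ℕ) → (∀ i → m i > 0) →
    (χ : ℕ) → IsChromaticNumber (expAdj G m) χ →
    (k : ℕ) → χ ≤ k →
    IndicatedColorable _≟E_ (expAdj G m) k
theorem3p17 G (_ , part , multipartite) m _ _ ((f , f-proper) , _) k χ≤k =
  Strategy.ann-wins G part multipartite m f f-proper k χ≤k
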